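{- Let $n\ge 1$ and let $G_n$ be a caterpillar graph with central path $P_n=v_1v_2\cdots v_n$ such that $l(v_i)\ge 3$ for every $v_i\in V(P_n)$. Then $\lambda_H(G_n)=\sum_{i=1}^{n} l(v_i)-n$.
   Context: A caterpillar graph $G_n$ is a tree containing a path $P_n$ on $n$ vertices (its central path) such that every vertex of $G_n$ is at distance at most $1$ from $P_n$; every vertex of $G_n$ not on $P_n$ is a leaf (vertex of degree $1$) adjacent to a vertex of $P_n$. For a vertex $v$, $l(v)$ denotes the number of leaves adjacent to $v$. For a graph $G$, the Hamiltonian complete number $\lambda_H(G)$ is the minimum number of edges not in $E(G)$, joining vertices of $G$, whose addition to $G$ produces a graph containing a Hamiltonian (spanning) cycle. -}

module Defs where

open import Data.Nat using (ℕ; suc; _≤_)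
open import Data.Fin using (Fin; toℕ)
open import Data.Product using (Σ; _×_; _,_; proj₁; proj₂)
open import Data.Sum using (_⊎_; inj₁; inj₂)
open import Data.List using (List; length; take; _++_; map; allFin)
open import Data.Nat.ListAction using (sum)
open import Data.List.Membership.Propositional using (_∈_)
open import Data.List.Relation.Unary.All using (All)
open import Data.List.Relation.Unary.Linked using (Linked)
open import Data.List.Relation.Unary.AllPairs using (AllPairs)
open import Data.List.Relation.Unary.Unique.Propositional using (Unique)
open import Relation.Binary.PropositionalEquality using (_≡_; _≢_)
open import Relation.Nullary using (¬_)
open import Data.Empty using (⊥)
open import Data.Unit using (⊤)

-- General (simple, undirected) graphs: a vertex type V and an adjacency
-- relation E (assumed symmetric and irreflexive by the user).

AddEdges : {V : Set} → (V → V → Set) → List (V × V) → V → V → Set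
AddEdges E F u v = E u v ⊎ ((u , v) ∈ F ⊎ (v , u) ∈ F)

IsHamiltonianCycle : {V : Set} → (V → V → Set) → List V → Set
IsHamiltonianCycle {V} E c =
  (3 ≤ length c) × Unique c × ((v : V) → v ∈ c) × Linked E (c ++ take 1 c)

HasHamiltonianCycle : {V : Set} → (V → V → Set) → Set
HasHamiltonianCycle {V} E = Σ (List V) (λ c → IsHamiltonianCycle E c)

ValidNewEdges : {V : Set} → (V → V → Set) → List (V × V) → Set
ValidNewEdges E F =
  All (λ p → (proj₁ p ≢ proj₂ p) × ¬ E (proj₁ p) (proj₂ p)) F
  × AllPairs (λ p q → (p ≢ q) × (p ≢ (proj₂ q , proj₁ q))) F

HamiltonianCompleteNumber : {V : Set} → (V → V → Set) → ℕ → Set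
HamiltonianCompleteNumber {V} E k =
  Σ (List (V × V)) (λ F → ValidNewEdges E F × length F ≡ k
                          × HasHamiltonianCycle (AddEdges E F))
  × ((F : List (V × V)) → ValidNewEdges E F
       → HasHamiltonianCycle (AddEdges E F) → k ≤ length F)

-- The caterpillar with central path v_0 … v_{n-1} (Fin n) where v_i
-- carries ℓ i pendant leaves.

CatVertex : (n : ℕ) → (Fin n → ℕ) → Set
CatVertex n ℓ = Fin n ⊎ Σ (Fin n) (λ i → Fin (ℓ i))

CatAdj : (n : ℕ) (ℓ : Fin n → ℕ) → CatVertex n ℓ → CatVertex n ℓ → Set
CatAdj n ℓ (inj₁ i) (inj₁ j) = (toℕ j ≡ suc (toℕ i)) ⊎ (toℕ i ≡ suc (toℕ j))
CatAdj n ℓ (inj₁ i) (inj₂ (j , _)) = i ≡ j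
CatAdj n ℓ (inj₂ (i , _)) (inj₁ j) = i ≡ j
CatAdj n ℓ (inj₂ _) (inj₂ _) = ⊥

totalLeaves : (n : ℕ) → (Fin n → ℕ) → ℕ
totalLeaves n ℓ = sum (map ℓ (allFin n))

-- In a Hamiltonian cycle of G + F every edge of G has an endpoint on the central path, and each of
-- the n path vertices lies on just two cycle edges; so at most 2n of the n + Σ l(v_i) cycle edges
-- belong to G, and the others are distinct added edges, giving |F| ≥ Σ l(v_i) − n. Conversely, the
-- cycle that runs through the stars one after another, each v_i placed between two of its leaves,
-- uses 2n edges of G (l(v_i) ≥ 2 suffices), and its remaining edges form an admissible F of that size.

module Submission where

open import Defs
open import Level using (0ℓ)
open import Function using (_∘_; id)
open import Data.Bool using (true; false)
open import Data.Empty using (⊥; ⊥-elim)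
open import Data.Unit using (⊤; tt)
open import Data.Nat using (ℕ; suc; _+_; _∸_; _≤_; z≤n; s≤s; s≤s⁻¹; _≟_)
open import Data.Nat.Properties
open import Algebra.Properties.CommutativeSemigroup +-commutativeSemigroup using (x∙yz≈y∙xz)
open import Data.Nat.ListAction using (sum)
open import Data.Fin as Fin using (Fin; toℕ)
open import Data.Product using (_×_; _,_; proj₁; proj₂; swap; uncurry)
open import Data.Sum using (_⊎_; inj₁; inj₂; [_,_]′)
open import Data.List
  using (List; []; _∷_; _++_; _∷ʳ_; initLast; _∷ʳ′_; map; length; take; filter; concat; concatMap; allFin)
open import Data.List.Properties
  using (length-++; ++-assoc; length-map; filter-accept; length-removeAt′; length-tabulate)
open import Data.List.Membership.Propositional using (_∈_; lose)
open import Data.List.Membership.Propositional.Properties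
  using (∈-++⁺ʳ; ∈-filter⁺; ∈-map⁺; ∈-map⁻; ∈-allFin; ∈-concatMap⁺)
open import Data.List.Relation.Unary.Any as Any using (Any; here; there; _─_)
open import Data.List.Relation.Unary.All as All using (All; []; _∷_)
import Data.List.Relation.Unary.All.Properties as All
open import Data.List.Relation.Unary.AllPairs as AllPairs using (AllPairs; []; _∷_)
import Data.List.Relation.Unary.AllPairs.Properties as AllPairs
open import Data.List.Relation.Unary.Linked using (Linked; []; [-]; _∷_)
open import Data.List.Relation.Unary.Unique.Propositional using (Unique)
import Data.List.Relation.Unary.Unique.Propositional.Properties as Unique
open import Data.List.Relation.Binary.Disjoint.Propositional using (Disjoint)
open import Data.List.Relation.Binary.Permutation.Propositional using (_↭_; ↭-sym)
open import Data.List.Relation.Binary.Permutation.Propositional.Properties using (∷↭∷ʳ; ↭-length; filter-↭)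
open import Relation.Binary.PropositionalEquality
open import Relation.Nullary using (¬_; Dec; yes; no; does)
open import Relation.Nullary.Decidable using (_⊎-dec_)
open import Relation.Unary as U using (Pred)
open import Relation.Unary.Properties using (∁?)

-- Consecutive pairs of a list and the edges of a cycle

module _ {A : Set} where

  adjacentPairs : List A → List (A × A)
  adjacentPairs []           = []
  adjacentPairs (x ∷ [])     = []
  adjacentPairs (x ∷ y ∷ xs) = (x , y) ∷ adjacentPairs (y ∷ xs)

  cycleEdges : List A → List (A × A)
  cycleEdges c = adjacentPairs (c ++ take 1 c)

  DistinctEdges : A × A → A × A → Set
  DistinctEdges p q = (p ≢ q) × (p ≢ swap q)

  Loopless : A × A → Set
  Loopless p = proj₁ p ≢ proj₂ p

  module _ {R : A → A → Set} where

    Linked⇒All-adjacentPairs : ∀ {xs} → Linked R xs → All (uncurry R) (adjacentPairs xs)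
    Linked⇒All-adjacentPairs []       = []
    Linked⇒All-adjacentPairs [-]      = []
    Linked⇒All-adjacentPairs (r ∷ rs) = r ∷ Linked⇒All-adjacentPairs rs

    All-adjacentPairs⇒Linked : ∀ xs → All (uncurry R) (adjacentPairs xs) → Linked R xs
    All-adjacentPairs⇒Linked []           _        = []
    All-adjacentPairs⇒Linked (x ∷ [])     _        = [-]
    All-adjacentPairs⇒Linked (x ∷ y ∷ xs) (r ∷ rs) = r ∷ All-adjacentPairs⇒Linked (y ∷ xs) rs

  map-proj₁-adjacentPairs : ∀ xs y → map proj₁ (adjacentPairs (xs ∷ʳ y)) ≡ xs
  map-proj₁-adjacentPairs []           y = refl
  map-proj₁-adjacentPairs (x ∷ [])     y = refl
  map-proj₁-adjacentPairs (x ∷ x′ ∷ xs) y = cong (x ∷_) (map-proj₁-adjacentPairs (x′ ∷ xs) y)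

  map-proj₂-adjacentPairs : ∀ x xs → map proj₂ (adjacentPairs (x ∷ xs)) ≡ xs
  map-proj₂-adjacentPairs x []       = refl
  map-proj₂-adjacentPairs x (y ∷ xs) = cong (y ∷_) (map-proj₂-adjacentPairs y xs)

  map-proj₁-cycleEdges : ∀ c → map proj₁ (cycleEdges c) ≡ c
  map-proj₁-cycleEdges []      = refl
  map-proj₁-cycleEdges (x ∷ t) = map-proj₁-adjacentPairs (x ∷ t) x

  map-proj₂-cycleEdges : ∀ c → map proj₂ (cycleEdges c) ↭ c
  map-proj₂-cycleEdges []      = _↭_.refl
  map-proj₂-cycleEdges (x ∷ t) rewrite map-proj₂-adjacentPairs x (t ∷ʳ x) = ↭-sym (∷↭∷ʳ x t)

  length-cycleEdges : ∀ c → length (cycleEdges c) ≡ length c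
  length-cycleEdges c = trans (sym (length-map proj₁ (cycleEdges c))) (cong length (map-proj₁-cycleEdges c))

  ∈-adjacentPairs⁻ : ∀ {p} x xs → p ∈ adjacentPairs (x ∷ xs) → proj₁ p ∈ x ∷ xs × proj₂ p ∈ xs
  ∈-adjacentPairs⁻ x (y ∷ xs) (here refl) = here refl , here refl
  ∈-adjacentPairs⁻ x (y ∷ xs) (there m)   =
    let m₁ , m₂ = ∈-adjacentPairs⁻ y xs m in there m₁ , there m₂

  adjacentPairs-∷ʳ : ∀ xs u x → adjacentPairs (xs ∷ʳ u ∷ʳ x) ≡ adjacentPairs (xs ∷ʳ u) ∷ʳ (u , x)
  adjacentPairs-∷ʳ []           u x = refl
  adjacentPairs-∷ʳ (y ∷ [])     u x = refl
  adjacentPairs-∷ʳ (y ∷ z ∷ ys) u x = cong ((y , z) ∷_) (adjacentPairs-∷ʳ (z ∷ ys) u x)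

  adjacentPairs-loopless : ∀ {xs} → Unique xs → All Loopless (adjacentPairs xs)
  adjacentPairs-loopless {[]}         _                 = []
  adjacentPairs-loopless {x ∷ []}     _                 = []
  adjacentPairs-loopless {x ∷ y ∷ xs} ((x≢y ∷ _) ∷ uniq) = x≢y ∷ adjacentPairs-loopless uniq

  adjacentPairs-distinct : ∀ {xs} → Unique xs → AllPairs DistinctEdges (adjacentPairs xs)
  adjacentPairs-distinct {[]}         _            = []
  adjacentPairs-distinct {x ∷ []}     _            = []
  adjacentPairs-distinct {x ∷ y ∷ xs} (x∉ ∷ uniq) =
    All.tabulate apart ∷ adjacentPairs-distinct uniq
    where
    apart : ∀ {q} → q ∈ adjacentPairs (y ∷ xs) → DistinctEdges (x , y) q
    apart m = let m₁ , m₂ = ∈-adjacentPairs⁻ y xs m in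
      (λ e → All.lookup x∉ m₁ (cong proj₁ e)) , (λ e → All.lookup x∉ (there m₂) (cong proj₁ e))

  cycleEdges-loopless : ∀ {c} → 2 ≤ length c → Unique c → All Loopless (cycleEdges c)
  cycleEdges-loopless {x ∷ t} 2≤∣c∣ uniq@(x∉ ∷ _) with initLast t
  ... | []       with () ← s≤s⁻¹ 2≤∣c∣
  ... | zs ∷ʳ′ u rewrite adjacentPairs-∷ʳ (x ∷ zs) u x =
    All.++⁺ (adjacentPairs-loopless uniq) ((λ e → All.lookup x∉ (∈-++⁺ʳ zs (here refl)) (sym e)) ∷ [])

  cycleEdges-distinct : ∀ {c} → 3 ≤ length c → Unique c → AllPairs DistinctEdges (cycleEdges c)
  cycleEdges-distinct {x ∷ t} 3≤∣c∣ uniq with initLast t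
  ... | []            with () ← s≤s⁻¹ 3≤∣c∣
  ... | [] ∷ʳ′ u      with () ← s≤s⁻¹ (s≤s⁻¹ 3≤∣c∣)
  cycleEdges-distinct {x ∷ _} _ uniq@(x∉ ∷ y∉ ∷ _) | (y ∷ ys) ∷ʳ′ u rewrite adjacentPairs-∷ʳ (x ∷ y ∷ ys) u x =
    AllPairs.++⁺ (adjacentPairs-distinct uniq) ([] ∷ []) (All.map (_∷ []) (head ∷ All.tabulate tail))
    where
    u∈ : u ∈ ys ∷ʳ u
    u∈ = ∈-++⁺ʳ ys (here refl)
    head : DistinctEdges (x , y) (u , x)
    head = (λ e → All.lookup x∉ (there u∈) (cong proj₁ e)) , (λ e → All.lookup y∉ u∈ (cong proj₂ e))
    tail : ∀ {p} → p ∈ adjacentPairs (y ∷ ys ∷ʳ u) → DistinctEdges p (u , x)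
    tail m = let m₁ , m₂ = ∈-adjacentPairs⁻ y (ys ∷ʳ u) m in
      (λ e → All.lookup x∉ (there m₂) (sym (cong proj₂ e))) , (λ e → All.lookup x∉ m₁ (sym (cong proj₁ e)))

  insertSecond : A → List A → List A
  insertSecond v []       = v ∷ []
  insertSecond v (x ∷ xs) = x ∷ v ∷ xs

  length-insertSecond : ∀ v xs → length (insertSecond v xs) ≡ suc (length xs)
  length-insertSecond v []       = refl
  length-insertSecond v (x ∷ xs) = refl

  ∈-insertSecond⁻ : ∀ {y} v xs → y ∈ insertSecond v xs → y ≡ v ⊎ y ∈ xs
  ∈-insertSecond⁻ v []       (here e)         = inj₁ e
  ∈-insertSecond⁻ v (x ∷ xs) (here e)         = inj₂ (here e)
  ∈-insertSecond⁻ v (x ∷ xs) (there (here e)) = inj₁ e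
  ∈-insertSecond⁻ v (x ∷ xs) (there (there m)) = inj₂ (there m)

  ∈-insertSecond⁺ : ∀ {y} v xs → y ≡ v ⊎ y ∈ xs → y ∈ insertSecond v xs
  ∈-insertSecond⁺ v []       (inj₁ e)         = here e
  ∈-insertSecond⁺ v (x ∷ xs) (inj₁ e)         = there (here e)
  ∈-insertSecond⁺ v (x ∷ xs) (inj₂ (here e))  = here e
  ∈-insertSecond⁺ v (x ∷ xs) (inj₂ (there m)) = there (there m)

  insertSecond-unique : ∀ {v xs} → All (v ≢_) xs → Unique xs → Unique (insertSecond v xs)
  insertSecond-unique {xs = []}     _             _              = [] ∷ []
  insertSecond-unique {xs = x ∷ xs} (v≢x ∷ v∉xs) (x∉xs ∷ uniq) = ((v≢x ∘ sym) ∷ x∉xs) ∷ v∉xs ∷ uniq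

length-allFin : ∀ m → length (allFin m) ≡ m
length-allFin m = length-tabulate id

length-≤-concatMap : ∀ {A B : Set} (f : A → List B) {x xs} → x ∈ xs → length (f x) ≤ length (concatMap f xs)
length-≤-concatMap f {xs = y ∷ xs} (here refl) =
  ≤-trans (m≤m+n _ _) (≤-reflexive (sym (length-++ (f y))))
length-≤-concatMap f {xs = y ∷ xs} (there m) =
  ≤-trans (length-≤-concatMap f m) (≤-trans (m≤n+m _ _) (≤-reflexive (sym (length-++ (f y)))))

-- Counting

length-filter-∷ : ∀ {A : Set} {P : Pred A 0ℓ} (P? : U.Decidable P) x xs →
                  length (filter P? xs) ≤ length (filter P? (x ∷ xs))
length-filter-∷ P? x xs with does (P? x)
... | true  = n≤1+n _
... | false = ≤-refl

module _ {A : Set} {P : Pred A 0ℓ} (P? : U.Decidable P) where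

  length-filter+length-filter-∁ : ∀ xs → length (filter P? xs) + length (filter (∁? P?) xs) ≡ length xs
  length-filter+length-filter-∁ []       = refl
  length-filter+length-filter-∁ (x ∷ xs) with P? x
  ... | yes _ = cong suc (length-filter+length-filter-∁ xs)
  ... | no  _ = trans (+-suc _ _) (cong suc (length-filter+length-filter-∁ xs))

  length-filter-≤-∪ : {Q R : Pred A 0ℓ} (Q? : U.Decidable Q) (R? : U.Decidable R) → (∀ {x} → P x → Q x ⊎ R x) →
                      ∀ xs → length (filter P? xs) ≤ length (filter Q? xs) + length (filter R? xs)
  length-filter-≤-∪ Q? R? cover []       = z≤n
  length-filter-≤-∪ Q? R? cover (x ∷ xs) with P? x | length-filter-≤-∪ Q? R? cover xs
  ... | no  _  | ih = ≤-trans ih (+-mono-≤ (length-filter-∷ Q? x xs) (length-filter-∷ R? x xs))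
  ... | yes px | ih with cover px
  ...   | inj₁ qx = begin
    suc (length (filter P? xs))                                ≤⟨ s≤s (≤-trans ih (+-monoʳ-≤ _ (length-filter-∷ R? x xs))) ⟩
    suc (length (filter Q? xs)) + length (filter R? (x ∷ xs))  ≡⟨ cong (λ ys → length ys + _) (filter-accept Q? qx) ⟨
    length (filter Q? (x ∷ xs)) + length (filter R? (x ∷ xs))  ∎
    where open ≤-Reasoning
  ...   | inj₂ rx = begin
    suc (length (filter P? xs))                                ≤⟨ s≤s (≤-trans ih (+-monoˡ-≤ _ (length-filter-∷ Q? x xs))) ⟩
    suc (length (filter Q? (x ∷ xs)) + length (filter R? xs))  ≡⟨ +-suc _ _ ⟨
    length (filter Q? (x ∷ xs)) + suc (length (filter R? xs))  ≡⟨ cong (λ ys → _ + length ys) (filter-accept R? rx) ⟨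
    length (filter Q? (x ∷ xs)) + length (filter R? (x ∷ xs))  ∎
    where open ≤-Reasoning

  length-filter-map : {B : Set} (f : B → A) → ∀ xs → length (filter P? (map f xs)) ≡ length (filter (P? ∘ f) xs)
  length-filter-map f []       = refl
  length-filter-map f (x ∷ xs) with does (P? (f x))
  ... | true  = cong suc (length-filter-map f xs)
  ... | false = length-filter-map f xs

module _ {B : Set} {P Q : B → Set} where

  Any-─ : ∀ {ys} → Any P ys → (k : Any Q ys) → (∀ {y} → P y → Q y → ⊥) → Any P (ys ─ k)
  Any-─ (here p)  (here q)  apart = ⊥-elim (apart p q)
  Any-─ (here p)  (there _) _     = here p
  Any-─ (there m) (here _)  _     = m
  Any-─ (there m) (there k) apart = there (Any-─ m k apart)

module _ {A B : Set} {R : A → A → Set} (S : A → B → Set)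
         (exclusive : ∀ {x x′ y} → R x x′ → S x y → S x′ y → ⊥) where

  distinctRepresentatives⇒length≤ : ∀ {xs ys} → AllPairs R xs → All (λ x → Any (S x) ys) xs →
                                    length xs ≤ length ys
  distinctRepresentatives⇒length≤ {[]}          _          _        = z≤n
  distinctRepresentatives⇒length≤ {x ∷ xs} {ys} (Rx ∷ Rxs) (w ∷ ws) = begin
    suc (length xs)        ≤⟨ s≤s (distinctRepresentatives⇒length≤ Rxs (All.zipWith avoid (Rx , ws))) ⟩
    suc (length (ys ─ w))  ≡⟨ length-removeAt′ ys (Any.index w) ⟨
    length ys              ∎
    where
    open ≤-Reasoning
    avoid : ∀ {x′} → R x x′ × Any (S x′) ys → Any (S x′) (ys ─ w)
    avoid (Rxx′ , w′) = Any-─ w′ w (λ s′ s → exclusive Rxx′ s s′)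

module _ {A : Set} where

  Unique⊆⇒length≤ : ∀ {xs ys : List A} → Unique xs → All (_∈ ys) xs → length xs ≤ length ys
  Unique⊆⇒length≤ = distinctRepresentatives⇒length≤ _≡_ (λ x≢x′ e e′ → x≢x′ (trans e (sym e′)))

  DistinctEdges⇒length≤ : ∀ {ps F : List (A × A)} → AllPairs DistinctEdges ps →
                          All (λ p → p ∈ F ⊎ swap p ∈ F) ps → length ps ≤ length F
  DistinctEdges⇒length≤ distinct inF =
    distinctRepresentatives⇒length≤ Represents exclusive distinct (All.map [ Any.map inj₁ , Any.map inj₂ ]′ inF)
    where
    Represents : A × A → A × A → Set
    Represents p q = p ≡ q ⊎ swap p ≡ q
    exclusive : ∀ {p p′ q} → DistinctEdges p p′ → Represents p q → Represents p′ q → ⊥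
    exclusive (p≢p′ , _)  (inj₁ e) (inj₁ e′) = p≢p′ (trans e (sym e′))
    exclusive (_ , p≢p′ʳ) (inj₁ e) (inj₂ e′) = p≢p′ʳ (trans e (sym e′))
    exclusive (_ , p≢p′ʳ) (inj₂ e) (inj₁ e′) = p≢p′ʳ (cong swap (trans e (sym e′)))
    exclusive (p≢p′ , _)  (inj₂ e) (inj₂ e′) = p≢p′ (cong swap (trans e (sym e′)))

module _ {A : Set} {P : Pred (A × A) 0ℓ} (P? : U.Decidable P) where

  length-filter-adjacentPairs-++ : ∀ xs ys →
    length (filter P? (adjacentPairs ys)) ≤ length (filter P? (adjacentPairs (xs ++ ys)))
  length-filter-adjacentPairs-++ []       ys = ≤-refl
  length-filter-adjacentPairs-++ (x ∷ xs) ys =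
    ≤-trans (length-filter-adjacentPairs-++ xs ys) (extend (xs ++ ys))
    where
    extend : ∀ zs → length (filter P? (adjacentPairs zs)) ≤ length (filter P? (adjacentPairs (x ∷ zs)))
    extend []       = z≤n
    extend (z ∷ zs) = length-filter-∷ P? (x , z) (adjacentPairs (z ∷ zs))

-- Cycles in a graph with added edges

IsCycle : {V : Set} → (V → V → Set) → List V → Set
IsCycle E c = (3 ≤ length c) × Unique c × Linked E (c ++ take 1 c)

data StartsWith2Path {V : Set} (E : V → V → Set) : List V → Set where
  2path : ∀ {x v y ys} → E x v → E v y → StartsWith2Path E (x ∷ v ∷ y ∷ ys)

insertSecond-2path : ∀ {A : Set} {E : A → A → Set} {v xs} → All (λ x → E x v × E v x) xs → 2 ≤ length xs →
                     StartsWith2Path E (insertSecond v xs)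
insertSecond-2path {xs = _ ∷ _ ∷ _} ((e₁ , _) ∷ (_ , e₂) ∷ _) _ = 2path e₁ e₂
insertSecond-2path {xs = _ ∷ []}    _ (s≤s ())

module _ {V : Set} {E : V → V → Set} (E? : ∀ u v → Dec (E u v)) where

  oldEdges newEdges : List V → List (V × V)
  oldEdges c = filter (uncurry E?) (cycleEdges c)
  newEdges c = filter (∁? (uncurry E?)) (cycleEdges c)

  newEdges-valid : ∀ {c} → 3 ≤ length c → Unique c → ValidNewEdges E (newEdges c)
  newEdges-valid {c} 3≤∣c∣ uniq =
      All.zipWith id (All.filter⁺ _ (cycleEdges-loopless (≤-trans (n≤1+n 2) 3≤∣c∣) uniq) , All.all-filter _ (cycleEdges c))
    , AllPairs.filter⁺ _ (cycleEdges-distinct 3≤∣c∣ uniq)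

  newEdges-complete : ∀ c → Linked (AddEdges E (newEdges c)) (c ++ take 1 c)
  newEdges-complete c = All-adjacentPairs⇒Linked _ (All.tabulate edge)
    where
    edge : ∀ {p} → p ∈ cycleEdges c → AddEdges E (newEdges c) (proj₁ p) (proj₂ p)
    edge {p} m with uncurry E? p
    ... | yes e = inj₁ e
    ... | no ¬e = inj₂ (inj₁ (∈-filter⁺ (∁? (uncurry E?)) m ¬e))

  length-newEdges≤ : ∀ {F c} → IsCycle (AddEdges E F) c → length (newEdges c) ≤ length F
  length-newEdges≤ {F} {c} (3≤∣c∣ , uniq , linked) =
    DistinctEdges⇒length≤ (AllPairs.filter⁺ _ (cycleEdges-distinct 3≤∣c∣ uniq))
      (All.zipWith inF (All.filter⁺ _ (Linked⇒All-adjacentPairs linked) , All.all-filter _ (cycleEdges c)))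
    where
    inF : ∀ {p} → AddEdges E F (proj₁ p) (proj₂ p) × ¬ E (proj₁ p) (proj₂ p) → p ∈ F ⊎ swap p ∈ F
    inF (inj₁ e , ¬e)  = ⊥-elim (¬e e)
    inF (inj₂ p∈F , _) = p∈F

  length-oldEdges+length-newEdges : ∀ c → length (oldEdges c) + length (newEdges c) ≡ length c
  length-oldEdges+length-newEdges c =
    trans (length-filter+length-filter-∁ (uncurry E?) (cycleEdges c)) (length-cycleEdges c)

  module _ {S : Pred V 0ℓ} (S? : U.Decidable S) (cover : ∀ {u v} → E u v → S u ⊎ S v) where

    length-oldEdges≤ : ∀ c → length (oldEdges c) ≤ length (filter S? c) + length (filter S? c)
    length-oldEdges≤ c = begin
      length (oldEdges c)
        ≤⟨ length-filter-≤-∪ (uncurry E?) (S? ∘ proj₁) (S? ∘ proj₂) cover (cycleEdges c) ⟩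
      length (filter (S? ∘ proj₁) (cycleEdges c)) + length (filter (S? ∘ proj₂) (cycleEdges c))
        ≡⟨ cong₂ _+_ (length-filter-map S? proj₁ (cycleEdges c)) (length-filter-map S? proj₂ (cycleEdges c)) ⟨
      length (filter S? (map proj₁ (cycleEdges c))) + length (filter S? (map proj₂ (cycleEdges c)))
        ≡⟨ cong₂ _+_ (cong (length ∘ filter S?) (map-proj₁-cycleEdges c))
                     (↭-length (filter-↭ S? (map-proj₂-cycleEdges c))) ⟩
      length (filter S? c) + length (filter S? c) ∎
      where open ≤-Reasoning

    cycle-length≤ : ∀ {F c} → IsCycle (AddEdges E F) c →
                    length c ≤ length (filter S? c) + (length (filter S? c) + length F)
    cycle-length≤ {F} {c} cycle = begin
      length c                                                  ≡⟨ length-oldEdges+length-newEdges c ⟨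
      length (oldEdges c) + length (newEdges c)                 ≤⟨ +-mono-≤ (length-oldEdges≤ c) (length-newEdges≤ cycle) ⟩
      (length (filter S? c) + length (filter S? c)) + length F  ≡⟨ +-assoc (length (filter S? c)) _ _ ⟩
      length (filter S? c) + (length (filter S? c) + length F)  ∎
      where open ≤-Reasoning

  length-edges-concat≥ : ∀ {bs} → All (StartsWith2Path E) bs → ∀ ws →
    length bs + length bs ≤ length (filter (uncurry E?) (adjacentPairs (concat bs ++ ws)))
  length-edges-concat≥ []                                          ws = z≤n
  length-edges-concat≥ {_ ∷ bs} (2path {x} {v} {y} {ys} e₁ e₂ ∷ ps) ws = begin
    suc (length bs) + suc (length bs)              ≡⟨ cong suc (+-suc _ _) ⟩
    suc (suc (length bs + length bs))              ≤⟨ s≤s (s≤s (≤-trans (length-edges-concat≥ ps ws)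
                                                         (length-filter-adjacentPairs-++ (uncurry E?) (y ∷ ys) (concat bs ++ ws)))) ⟩
    suc (suc (old (y ∷ ys ++ concat bs ++ ws)))    ≡⟨ cong (λ zs → suc (suc (old (y ∷ zs)))) (++-assoc ys (concat bs) ws) ⟨
    suc (suc (old (y ∷ (ys ++ concat bs) ++ ws)))  ≡⟨ trans (cong length (filter-accept (uncurry E?) e₁))
                                                            (cong (suc ∘ length) (filter-accept (uncurry E?) e₂)) ⟨
    old ((x ∷ v ∷ y ∷ ys ++ concat bs) ++ ws)      ∎
    where
    open ≤-Reasoning
    old : List V → ℕ
    old zs = length (filter (uncurry E?) (adjacentPairs zs))

  length-newEdges-concat : ∀ {bs} → All (StartsWith2Path E) bs →
    length (newEdges (concat bs)) + (length bs + length bs) ≤ length (concat bs)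
  length-newEdges-concat {bs} ps = begin
    length (newEdges (concat bs)) + (length bs + length bs)
      ≤⟨ +-monoʳ-≤ _ (length-edges-concat≥ ps (take 1 (concat bs))) ⟩
    length (newEdges (concat bs)) + length (oldEdges (concat bs))
      ≡⟨ +-comm (length (newEdges (concat bs))) _ ⟩
    length (oldEdges (concat bs)) + length (newEdges (concat bs))
      ≡⟨ length-oldEdges+length-newEdges (concat bs) ⟩
    length (concat bs) ∎
    where open ≤-Reasoning

-- Caterpillars

module Caterpillar (n : ℕ) (ℓ : Fin n → ℕ) where

  CatAdj? : ∀ u v → Dec (CatAdj n ℓ u v)
  CatAdj? (inj₁ i)       (inj₁ j)       = (toℕ j ≟ suc (toℕ i)) ⊎-dec (toℕ i ≟ suc (toℕ j))
  CatAdj? (inj₁ i)       (inj₂ (j , _)) = i Fin.≟ j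
  CatAdj? (inj₂ (i , _)) (inj₁ j)       = i Fin.≟ j
  CatAdj? (inj₂ _)       (inj₂ _)       = no λ ()

  IsSpine : Pred (CatVertex n ℓ) 0ℓ
  IsSpine (inj₁ _) = ⊤
  IsSpine (inj₂ _) = ⊥

  isSpine? : U.Decidable IsSpine
  isSpine? (inj₁ _) = yes tt
  isSpine? (inj₂ _) = no λ ()

  spine-cover : ∀ {u v} → CatAdj n ℓ u v → IsSpine u ⊎ IsSpine v
  spine-cover {inj₁ _}          _ = inj₁ tt
  spine-cover {inj₂ _} {inj₁ _} _ = inj₂ tt

  length-filter-isSpine≤ : ∀ {c} → Unique c → length (filter isSpine? c) ≤ n
  length-filter-isSpine≤ {c} uniq = begin
    length (filter isSpine? c)    ≤⟨ Unique⊆⇒length≤ (Unique.filter⁺ isSpine? uniq)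
                                                     (All.map onSpine (All.all-filter isSpine? c)) ⟩
    length (map inj₁ (allFin n))  ≡⟨ length-map inj₁ (allFin n) ⟩
    length (allFin n)             ≡⟨ length-allFin n ⟩
    n                             ∎
    where
    open ≤-Reasoning
    onSpine : ∀ {v} → IsSpine v → v ∈ map inj₁ (allFin n)
    onSpine {inj₁ i} _ = ∈-map⁺ inj₁ (∈-allFin i)

  anchor : CatVertex n ℓ → Fin n
  anchor (inj₁ i)       = i
  anchor (inj₂ (i , _)) = i

  leaves : Fin n → List (CatVertex n ℓ)
  leaves i = map (λ j → inj₂ (i , j)) (allFin (ℓ i))

  -- v_i sits between its first two leaves, so each block opens with two edges of the caterpillar.
  block : Fin n → List (CatVertex n ℓ)
  block i = insertSecond (inj₁ i) (leaves i)

  tour : List (CatVertex n ℓ)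
  tour = concatMap block (allFin n)

  length-block : ∀ i → length (block i) ≡ suc (ℓ i)
  length-block i = begin
    length (block i)             ≡⟨ length-insertSecond (inj₁ i) (leaves i) ⟩
    suc (length (leaves i))      ≡⟨ cong suc (length-map _ (allFin (ℓ i))) ⟩
    suc (length (allFin (ℓ i)))  ≡⟨ cong suc (length-allFin (ℓ i)) ⟩
    suc (ℓ i)                    ∎
    where open ≡-Reasoning

  anchor-block : ∀ i {v} → v ∈ block i → anchor v ≡ i
  anchor-block i m with ∈-insertSecond⁻ (inj₁ i) (leaves i) m
  ... | inj₁ refl = refl
  ... | inj₂ m′ with ∈-map⁻ _ m′
  ...   | _ , _ , refl = refl

  ∈-block : ∀ v → v ∈ block (anchor v)
  ∈-block (inj₁ i)       = ∈-insertSecond⁺ (inj₁ i) (leaves i) (inj₁ refl)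
  ∈-block (inj₂ (i , j)) = ∈-insertSecond⁺ (inj₁ i) (leaves i) (inj₂ (∈-map⁺ _ (∈-allFin j)))

  block-unique : ∀ i → Unique (block i)
  block-unique i = insertSecond-unique (All.map⁺ (All.universal (λ _ ()) _))
                                       (Unique.map⁺ (λ { refl → refl }) (Unique.allFin⁺ (ℓ i)))

  block-2path : ∀ i → 2 ≤ ℓ i → StartsWith2Path (CatAdj n ℓ) (block i)
  block-2path i 2≤ℓ = insertSecond-2path (All.map⁺ (All.universal (λ _ → refl , refl) _))
    (subst (2 ≤_) (sym (trans (length-map _ (allFin (ℓ i))) (length-allFin (ℓ i)))) 2≤ℓ)

  tour-unique : Unique tour
  tour-unique = Unique.concat⁺ (All.map⁺ (All.universal block-unique _))
    (AllPairs.map⁺ (AllPairs.map disjoint (Unique.allFin⁺ n)))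
    where
    disjoint : ∀ {i j} → i ≢ j → Disjoint (block i) (block j)
    disjoint i≢j (mi , mj) = i≢j (trans (sym (anchor-block _ mi)) (anchor-block _ mj))

  ∈-tour : ∀ v → v ∈ tour
  ∈-tour v = ∈-concatMap⁺ block (lose (∈-allFin (anchor v)) (∈-block v))

  length-tour : length tour ≡ n + totalLeaves n ℓ
  length-tour = trans (length-concatMap (allFin n)) (cong (_+ totalLeaves n ℓ) (length-allFin n))
    where
    length-concatMap : ∀ is → length (concatMap block is) ≡ length is + sum (map ℓ is)
    length-concatMap []       = refl
    length-concatMap (i ∷ is) = begin
      length (block i ++ concatMap block is)             ≡⟨ length-++ (block i) ⟩
      length (block i) + length (concatMap block is)     ≡⟨ cong₂ _+_ (length-block i) (length-concatMap is) ⟩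
      suc (ℓ i + (length is + sum (map ℓ is)))           ≡⟨ cong suc (x∙yz≈y∙xz (ℓ i) (length is) _) ⟩
      suc (length is + (ℓ i + sum (map ℓ is)))           ∎
      where open ≡-Reasoning

  3≤length-tour : (i : Fin n) → 2 ≤ ℓ i → 3 ≤ length tour
  3≤length-tour i 2≤ℓ = begin
    3                 ≤⟨ s≤s 2≤ℓ ⟩
    suc (ℓ i)         ≡⟨ length-block i ⟨
    length (block i)  ≤⟨ length-≤-concatMap block (∈-allFin i) ⟩
    length tour       ∎
    where open ≤-Reasoning

  tour-hamiltonian : 3 ≤ length tour → IsHamiltonianCycle (AddEdges (CatAdj n ℓ) (newEdges CatAdj? tour)) tour
  tour-hamiltonian 3≤∣tour∣ = 3≤∣tour∣ , tour-unique , ∈-tour , newEdges-complete CatAdj? tour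

  blocks-2path : (∀ i → 2 ≤ ℓ i) → All (StartsWith2Path (CatAdj n ℓ)) (map block (allFin n))
  blocks-2path 2≤ℓ = All.map⁺ (All.universal (λ i → block-2path i (2≤ℓ i)) (allFin n))

  length-blocks : length (map block (allFin n)) ≡ n
  length-blocks = trans (length-map block (allFin n)) (length-allFin n)

  length-newEdges-tour≤ : (∀ i → 2 ≤ ℓ i) → length (newEdges CatAdj? tour) ≤ totalLeaves n ℓ ∸ n
  length-newEdges-tour≤ 2≤ℓ = m+n≤o⇒m≤o∸n new (+-cancelˡ-≤ n (new + n) _ (begin
    n + (new + n)        ≡⟨ x∙yz≈y∙xz n new n ⟩
    new + (n + n)        ≡⟨ cong (λ k → new + (k + k)) length-blocks ⟨
    new + (length (map block (allFin n)) + length (map block (allFin n)))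
                         ≤⟨ length-newEdges-concat CatAdj? (blocks-2path 2≤ℓ) ⟩
    length tour          ≡⟨ length-tour ⟩
    n + totalLeaves n ℓ  ∎))
    where
    open ≤-Reasoning
    new : ℕ
    new = length (newEdges CatAdj? tour)

  length-completion≥ : ∀ F → HasHamiltonianCycle (AddEdges (CatAdj n ℓ) F) → totalLeaves n ℓ ∸ n ≤ length F
  length-completion≥ F (c , 3≤∣c∣ , uniq , covers , linked) = m≤n+o⇒m∸n≤o L n (+-cancelˡ-≤ n L (n + length F) (begin
    n + L               ≡⟨ length-tour ⟨
    length tour         ≤⟨ Unique⊆⇒length≤ tour-unique (All.tabulate (λ {v} _ → covers v)) ⟩
    length c            ≤⟨ cycle-length≤ CatAdj? isSpine? spine-cover (3≤∣c∣ , uniq , linked) ⟩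
    s + (s + length F)  ≤⟨ +-mono-≤ s≤n (+-monoˡ-≤ (length F) s≤n) ⟩
    n + (n + length F)  ∎))
    where
    open ≤-Reasoning
    L s : ℕ
    L = totalLeaves n ℓ
    s = length (filter isSpine? c)
    s≤n : s ≤ n
    s≤n = length-filter-isSpine≤ uniq

mainTheorem4 : (n : ℕ) → 1 ≤ n → (ℓ : Fin n → ℕ) → ((i : Fin n) → 3 ≤ ℓ i)
    → HamiltonianCompleteNumber (CatAdj n ℓ) (totalLeaves n ℓ ∸ n)
mainTheorem4 n 1≤n ℓ 3≤ℓ =
    (newEdges CatAdj? tour , newEdges-valid CatAdj? 3≤∣tour∣ tour-unique , ≤-antisym upper lower , tour , hamiltonian)
  , λ F _ → length-completion≥ F
  where
  open Caterpillar n ℓ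
  2≤ℓ : ∀ i → 2 ≤ ℓ i
  2≤ℓ i = ≤-trans (n≤1+n 2) (3≤ℓ i)
  3≤∣tour∣ : 3 ≤ length tour
  3≤∣tour∣ = 3≤length-tour (Fin.fromℕ< 1≤n) (2≤ℓ _)
  hamiltonian : IsHamiltonianCycle (AddEdges (CatAdj n ℓ) (newEdges CatAdj? tour)) tour
  hamiltonian = tour-hamiltonian 3≤∣tour∣
  upper : length (newEdges CatAdj? tour) ≤ totalLeaves n ℓ ∸ n
  upper = length-newEdges-tour≤ 2≤ℓ
  lower : totalLeaves n ℓ ∸ n ≤ length (newEdges CatAdj? tour)
  lower = length-completion≥ _ (tour , hamiltonian)
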